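{- Let $n\ge1$ and $\sigma\in\mathfrak{S}_n$, and let $\mathrm{Orb}(\sigma)=\{\epsilon_1\sigma(1)\,\epsilon_2\sigma(2)\cdots\epsilon_n\sigma(n):\epsilon_i\in\{ -1,1\}\}\subseteq\mathcal{B}_n$. Then $$\sum_{\pi\in\mathrm{Orb}(\sigma)}x^{\hat d(\pi)}=(1+x)^{\mathrm{dda}(\sigma)}\,2^{\mathrm{val}(\sigma)}\,(1+x^2)^{\mathrm{pk}(\sigma)},$$ where $\mathrm{dda},\mathrm{val},\mathrm{pk}$ of $\sigma$ are computed with the convention $\sigma(0)=\sigma(n+1)=n+1$.
   Context: $\mathcal{B}_n$ is the set of signed permutations of $[n]$: words $\pi(1)\cdots\pi(n)$ with entries in $\{\pm1,\dots,\pm n\}$ whose absolute values form a permutation of $[n]$. For $\pi\in\mathcal{B}_n$, $\hat d(\pi)$ is the number of $i\in[n-1]$ such that either $i$ is odd and $\pi(i)>\pi(i+1)$, or $i$ is even and $\pi(i)<\pi(i+1)$ (comparisons in the usual order of integers; position $0$ is not considered). For $\sigma\in\mathfrak{S}_n$ with $\sigma(0)=\sigma(n+1)=n+1$, $i\in[n]$ is a double ascent if $\sigma(i-1)<\sigma(i)<\sigma(i+1)$, a double descent if $\sigma(i-1)>\sigma(i)>\sigma(i+1)$, a valley if $\sigma(i-1)>\sigma(i)<\sigma(i+1)$, a peak if $\sigma(i-1)<\sigma(i)>\sigma(i+1)$; $\mathrm{val}$, $\mathrm{pk}$ count valleys and peaks, and $\mathrm{dda}$ counts double ascents plus double descents.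 -}

module Defs where

open import Data.Bool using (Bool; true; false; not; if_then_else_)
open import Data.Nat using (ℕ; zero; suc; _+_; _<ᵇ_)
open import Data.Integer as ℤ using (ℤ; +_; -_)
open import Data.Fin using (Fin; toℕ)
open import Data.Fin.Permutation using (Permutation′; _⟨$⟩ʳ_)
open import Data.List using (List; []; _∷_; map; _++_; concatMap)
open import Data.Vec as V using (Vec)
open import Relation.Nullary.Decidable using (⌊_⌋)

allSigns : (n : ℕ) → List (Vec Bool n)
allSigns zero = V.[] ∷ []
allSigns (suc n) = concatMap (λ v → (true V.∷ v) ∷ (false V.∷ v) ∷ []) (allSigns n)

signed : Bool → ℕ → ℤ
signed true  m = + m
signed false m = - (+ m)

word : {n : ℕ} → Permutation′ n → Vec ℕ n
word σ = V.tabulate (λ i → suc (toℕ (σ ⟨$⟩ʳ i)))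

applySigns : {n : ℕ} → Vec Bool n → Permutation′ n → Vec ℤ n
applySigns ε σ = V.zipWith signed ε (word σ)

-- Orb(σ), listed once for each sign vector ε (distinct ε give distinct words)
Orb : {n : ℕ} → Permutation′ n → List (Vec ℤ n)
Orb {n} σ = map (λ ε → applySigns ε σ) (allSigns n)

b2n : Bool → ℕ
b2n true = 1
b2n false = 0

dhatFrom : Bool → List ℤ → ℕ
dhatFrom odd (a ∷ b ∷ rest) =
  b2n (if odd then ⌊ b ℤ.<? a ⌋ else ⌊ a ℤ.<? b ⌋) + dhatFrom (not odd) (b ∷ rest)
dhatFrom odd _ = 0

dhat : {n : ℕ} → Vec ℤ n → ℕ
dhat w = dhatFrom true (V.toList w)   -- first position i = 1 is odd

countTriples : (ℕ → ℕ → ℕ → Bool) → List ℕ → ℕ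
countTriples f (a ∷ b ∷ c ∷ rest) = b2n (f a b c) + countTriples f (b ∷ c ∷ rest)
countTriples f _ = 0

extWord : {n : ℕ} → Permutation′ n → List ℕ
extWord {n} σ = suc n ∷ (V.toList (word σ) ++ (suc n ∷ []))

_∧_ : Bool → Bool → Bool
true ∧ b = b
false ∧ b = false

_∨_ : Bool → Bool → Bool
true ∨ b = true
false ∨ b = b

dda : {n : ℕ} → Permutation′ n → ℕ
dda σ = countTriples (λ a b c → ((a <ᵇ b) ∧ (b <ᵇ c)) ∨ ((b <ᵇ a) ∧ (c <ᵇ b))) (extWord σ)

val : {n : ℕ} → Permutation′ n → ℕ
val σ = countTriples (λ a b c → (b <ᵇ a) ∧ (b <ᵇ c)) (extWord σ)

pk : {n : ℕ} → Permutation′ n → ℕ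
pk σ = countTriples (λ a b c → (a <ᵇ b) ∧ (c <ᵇ b)) (extWord σ)

-- Whether i is a d̂-descent of εσ is decided
-- by the sign of the larger of σ(i), σ(i+1) alone, and in both pairs where σ(j)
-- is the larger entry the descent occurs iff ε_j = (-1)^{j+1}.  Hence
-- d̂(εσ) = Σ_j [ε_j = (-1)^{j+1}] m_j, where m_j counts the neighbours of σ(j)
-- smaller than σ(j) (the sentinels σ(0) = σ(n+1) = n+1 never are).  Summing out
-- the signs one at a time gives Π_j (1 + x^{m_j}), and m_j = 0, 1, 2 exactly when
-- j is a valley, a double ascent or descent, or a peak.

module Submission where

open import Defs
open import Data.Bool using (Bool; true; false; not; if_then_else_)
open import Data.Nat using (ℕ; zero; suc; _+_; _*_; _^_; _≥_; _<_; _≤_; _<ᵇ_; s≤s)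
open import Data.Nat.ListAction using (sum)
import Data.Nat.Properties as ℕ
open import Data.Nat.Tactic.RingSolver using (solve-∀)
open import Data.Integer as ℤ using (ℤ; +_; -_; +<+; -<+; -<-)
import Data.Integer.Properties as ℤ
open import Data.Fin using (Fin; toℕ)
import Data.Fin as Fin
import Data.Fin.Properties as Fin
open import Data.Fin.Permutation using (Permutation′; _⟨$⟩ʳ_; _⟨$⟩ˡ_; inverseˡ)
open import Data.List as List using (List; []; _∷_; _++_; map)
import Data.List.Properties as List
open import Data.List.Relation.Unary.All using (All; []; _∷_)
import Data.List.Relation.Unary.All.Properties as All
open import Data.List.Relation.Unary.Linked using (Linked; []; [-]; _∷_)
open import Data.List.Relation.Unary.Linked.Properties using (AllPairs⇒Linked)
import Data.List.Relation.Unary.Unique.Propositional.Properties as Unique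
open import Data.Vec as V using (Vec)
open import Relation.Binary using (tri<; tri≈; tri>)
open import Relation.Binary.PropositionalEquality
  using (_≡_; _≢_; refl; sym; trans; cong; cong₂; module ≡-Reasoning)
open import Relation.Nullary using (¬_)
open import Relation.Nullary.Decidable using (Dec; ⌊_⌋; isYes≗does; dec-true; dec-false)
open import Algebra.Properties.CommutativeSemigroup ℕ.*-commutativeSemigroup
  using (interchange)
open import Data.Empty using (⊥-elim)
open import Function using (_∘_)

open ≡-Reasoning

<ᵇ-true : ∀ {m n} → m < n → (m <ᵇ n) ≡ true
<ᵇ-true {zero} {suc n} _ = refl
<ᵇ-true {suc m} {suc n} (s≤s m<n) = <ᵇ-true m<n

<ᵇ-false : ∀ {m n} → n ≤ m → (m <ᵇ n) ≡ false
<ᵇ-false {m} {zero} _ = refl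
<ᵇ-false {suc m} {suc n} (s≤s n≤m) = <ᵇ-false n≤m

signed<+ : ∀ t {a b} → b < a → signed t b ℤ.< + a
signed<+ true b<a = +<+ b<a
signed<+ false {b = zero} b<a = +<+ b<a
signed<+ false {b = suc _} _ = -<+

-<signed : ∀ t {a b} → b < a → - (+ a) ℤ.< signed t b
-<signed true {a = suc _} _ = -<+
-<signed false {a = suc _} {b = zero} _ = -<+
-<signed false {a = suc _} {b = suc _} (s≤s b<a) = -<- b<a

⌊⌋-true : ∀ {P : Set} (d : Dec P) → P → ⌊ d ⌋ ≡ true
⌊⌋-true d p = trans (isYes≗does d) (dec-true d p)

⌊⌋-false : ∀ {P : Set} (d : Dec P) → ¬ P → ⌊ d ⌋ ≡ false
⌊⌋-false d ¬p = trans (isYes≗does d) (dec-false d ¬p)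

signed<?signed : ∀ s t {a b} → b < a → ⌊ signed t b ℤ.<? signed s a ⌋ ≡ s
signed<?signed true t b<a = ⌊⌋-true _ (signed<+ t b<a)
signed<?signed false t b<a = ⌊⌋-false _ (ℤ.<-asym (-<signed t b<a))

signed>?signed : ∀ s t {a b} → b < a → ⌊ signed s a ℤ.<? signed t b ⌋ ≡ not s
signed>?signed true t b<a = ⌊⌋-false _ (ℤ.<-asym (signed<+ t b<a))
signed>?signed false t b<a = ⌊⌋-true _ (-<signed t b<a)

-- charge (j odd) ε_j is the indicator [ε_j = (-1)^{j+1}].
charge : Bool → Bool → ℕ
charge odd s = b2n (if odd then s else not s)

descentAt : Bool → ℤ → ℤ → ℕ
descentAt odd p q = b2n (if odd then ⌊ q ℤ.<? p ⌋ else ⌊ p ℤ.<? q ⌋)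

descentAt-larger-left : ∀ odd s t {a b} → b < a →
  descentAt odd (signed s a) (signed t b) ≡ charge odd s
descentAt-larger-left true s t b<a = cong b2n (signed<?signed s t b<a)
descentAt-larger-left false s t b<a = cong b2n (signed>?signed s t b<a)

descentAt-larger-right : ∀ odd s t {a b} → a < b →
  descentAt odd (signed s a) (signed t b) ≡ charge (not odd) t
descentAt-larger-right true s t a<b = cong b2n (signed>?signed t s a<b)
descentAt-larger-right false s t a<b = cong b2n (signed<?signed t s a<b)

-- d̂ of the signed word, plus k further descents charged to its first entry
-- (those of pairs left of w in which that entry is the larger one).
chargedDhat : ∀ {m} → Bool → ℕ → Vec Bool (suc m) → Vec ℕ (suc m) → ℕ
chargedDhat odd k ε w =
  k * charge odd (V.head ε) + dhatFrom odd (V.toList (V.zipWith signed ε w))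

chargedDhat-∷ : ∀ odd k {m} a (w : Vec ℕ (suc m)) → a ≢ V.head w →
  (ε : Vec Bool (suc (suc m))) →
  chargedDhat odd k ε (a V.∷ w)
    ≡ (k + b2n (V.head w <ᵇ a)) * charge odd (V.head ε)
      + chargedDhat (not odd) (b2n (a <ᵇ V.head w)) (V.tail ε) w
chargedDhat-∷ odd k a (b V.∷ w) a≢b (s V.∷ t V.∷ ε) with ℕ.<-cmp a b
... | tri≈ _ a≡b _ = ⊥-elim (a≢b a≡b)
... | tri< a<b _ _ rewrite <ᵇ-true a<b | <ᵇ-false (ℕ.<⇒≤ a<b) = begin
  k * charge odd s + (descentAt odd (signed s a) (signed t b) + rest)
    ≡⟨ cong (λ d → k * charge odd s + (d + rest)) (descentAt-larger-right odd s t a<b) ⟩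
  k * charge odd s + (charge (not odd) t + rest)
    ≡⟨ arith k (charge odd s) (charge (not odd) t) rest ⟩
  (k + 0) * charge odd s + (1 * charge (not odd) t + rest) ∎
  where
  rest = dhatFrom (not odd) (signed t b ∷ V.toList (V.zipWith signed ε w))
  arith : ∀ k c c′ d → k * c + (c′ + d) ≡ (k + 0) * c + (1 * c′ + d)
  arith = solve-∀
... | tri> _ _ b<a rewrite <ᵇ-true b<a | <ᵇ-false (ℕ.<⇒≤ b<a) = begin
  k * charge odd s + (descentAt odd (signed s a) (signed t b) + rest)
    ≡⟨ cong (λ d → k * charge odd s + (d + rest)) (descentAt-larger-left odd s t b<a) ⟩
  k * charge odd s + (charge odd s + rest)
    ≡⟨ arith k (charge odd s) rest ⟩
  (k + 1) * charge odd s + rest ∎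
  where
  rest = dhatFrom (not odd) (signed t b ∷ V.toList (V.zipWith signed ε w))
  arith : ∀ k c d → k * c + (c + d) ≡ (k + 1) * c + d
  arith = solve-∀

isDoubleAscentOrDescent isValley isPeak : ℕ → ℕ → ℕ → Bool
isDoubleAscentOrDescent a b c = ((a <ᵇ b) ∧ (b <ᵇ c)) ∨ ((b <ᵇ a) ∧ (c <ᵇ b))
isValley a b c = (b <ᵇ a) ∧ (b <ᵇ c)
isPeak a b c = (a <ᵇ b) ∧ (c <ᵇ b)

smallerNeighbours : ℕ → ℕ → ℕ → ℕ
smallerNeighbours a b c = b2n (a <ᵇ b) + b2n (c <ᵇ b)

tripleProduct : (ℕ → ℕ → ℕ → ℕ) → List ℕ → ℕ
tripleProduct φ (a ∷ b ∷ c ∷ rest) = φ a b c * tripleProduct φ (b ∷ c ∷ rest)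
tripleProduct φ _ = 1

^-countTriples : ∀ u f L →
  u ^ countTriples f L ≡ tripleProduct (λ a b c → u ^ b2n (f a b c)) L
^-countTriples u f (a ∷ b ∷ c ∷ rest) = begin
  u ^ (b2n (f a b c) + countTriples f (b ∷ c ∷ rest))
    ≡⟨ ℕ.^-distribˡ-+-* u (b2n (f a b c)) _ ⟩
  u ^ b2n (f a b c) * u ^ countTriples f (b ∷ c ∷ rest)
    ≡⟨ cong (u ^ b2n (f a b c) *_) (^-countTriples u f (b ∷ c ∷ rest)) ⟩
  u ^ b2n (f a b c) * tripleProduct (λ a b c → u ^ b2n (f a b c)) (b ∷ c ∷ rest) ∎
^-countTriples u f [] = refl
^-countTriples u f (_ ∷ []) = refl
^-countTriples u f (_ ∷ _ ∷ []) = refl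

tripleProduct-* : ∀ φ ψ L →
  tripleProduct φ L * tripleProduct ψ L ≡ tripleProduct (λ a b c → φ a b c * ψ a b c) L
tripleProduct-* φ ψ (a ∷ b ∷ c ∷ rest) =
  trans (interchange (φ a b c) _ (ψ a b c) _)
        (cong (φ a b c * ψ a b c *_) (tripleProduct-* φ ψ (b ∷ c ∷ rest)))
tripleProduct-* φ ψ [] = refl
tripleProduct-* φ ψ (_ ∷ []) = refl
tripleProduct-* φ ψ (_ ∷ _ ∷ []) = refl

tripleProduct-cong : ∀ {φ ψ} → (∀ {a b c} → a ≢ b → b ≢ c → φ a b c ≡ ψ a b c) →
  ∀ {L} → Linked _≢_ L → tripleProduct φ L ≡ tripleProduct ψ L
tripleProduct-cong φ≡ψ (a≢b ∷ linked@(b≢c ∷ _)) =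
  cong₂ _*_ (φ≡ψ a≢b b≢c) (tripleProduct-cong φ≡ψ linked)
tripleProduct-cong φ≡ψ (_ ∷ [-]) = refl
tripleProduct-cong φ≡ψ [-] = refl
tripleProduct-cong φ≡ψ [] = refl

powers-countTriples : ∀ u v w f g h L →
  u ^ countTriples f L * v ^ countTriples g L * w ^ countTriples h L
    ≡ tripleProduct (λ a b c → u ^ b2n (f a b c) * v ^ b2n (g a b c) * w ^ b2n (h a b c)) L
powers-countTriples u v w f g h L = begin
  u ^ countTriples f L * v ^ countTriples g L * w ^ countTriples h L
    ≡⟨ cong₂ _*_ (cong₂ _*_ (^-countTriples u f L) (^-countTriples v g L))
                 (^-countTriples w h L) ⟩
  tripleProduct _ L * tripleProduct _ L * tripleProduct _ L
    ≡⟨ cong (_* tripleProduct _ L) (tripleProduct-* _ _ L) ⟩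
  tripleProduct _ L * tripleProduct _ L
    ≡⟨ tripleProduct-* _ _ L ⟩
  tripleProduct _ L ∎

module _ (x : ℕ) where

  sum-allSigns-suc : ∀ {m} (u : Bool → ℕ) (g : Vec Bool m → ℕ) →
    sum (map (λ ε → x ^ (u (V.head ε) + g (V.tail ε))) (allSigns (suc m)))
      ≡ (x ^ u true + x ^ u false) * sum (map (λ ε → x ^ g ε) (allSigns m))
  sum-allSigns-suc {m} u g = go (allSigns m)
    where
    p q : ℕ
    p = x ^ u true
    q = x ^ u false
    go : (L : List (Vec Bool m)) →
      sum (map (λ ε → x ^ (u (V.head ε) + g (V.tail ε)))
               (List.concatMap (λ v → (true V.∷ v) ∷ (false V.∷ v) ∷ []) L))
        ≡ (p + q) * sum (map (λ ε → x ^ g ε) L)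
    go [] = sym (ℕ.*-zeroʳ (p + q))
    go (v ∷ L) = begin
      x ^ (u true + g v) + (x ^ (u false + g v) + _)
        ≡⟨ cong₂ _+_ (ℕ.^-distribˡ-+-* x (u true) (g v))
                     (cong₂ _+_ (ℕ.^-distribˡ-+-* x (u false) (g v)) (go L)) ⟩
      p * x ^ g v + (q * x ^ g v + (p + q) * S)
        ≡⟨ arith p q (x ^ g v) S ⟩
      (p + q) * (x ^ g v + S) ∎
      where
      S = sum (map (λ ε → x ^ g ε) L)
      arith : ∀ p q G S → p * G + (q * G + (p + q) * S) ≡ (p + q) * (G + S)
      arith = solve-∀

  charge-sum : ∀ odd c → x ^ (c * charge odd true) + x ^ (c * charge odd false) ≡ 1 + x ^ c
  charge-sum true c rewrite ℕ.*-identityʳ c | ℕ.*-zeroʳ c = ℕ.+-comm (x ^ c) 1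
  charge-sum false c rewrite ℕ.*-identityʳ c | ℕ.*-zeroʳ c = refl

  signedSum : ∀ {m} → Bool → ℕ → Vec ℕ (suc m) → ℕ
  signedSum odd k w = sum (map (λ ε → x ^ chargedDhat odd k ε w) (allSigns _))

  signedSum-[-] : ∀ odd k a → signedSum odd k (a V.∷ V.[]) ≡ 1 + x ^ k
  signedSum-[-] odd k a = begin
    signedSum odd k (a V.∷ V.[])
      ≡⟨ cong sum (List.map-cong pointwise (allSigns 1)) ⟩
    sum (map (λ ε → x ^ (k * charge odd (V.head ε) + 0)) (allSigns 1))
      ≡⟨ sum-allSigns-suc {0} (λ s → k * charge odd s) (λ _ → 0) ⟩
    (x ^ (k * charge odd true) + x ^ (k * charge odd false)) * 1
      ≡⟨ ℕ.*-identityʳ _ ⟩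
    x ^ (k * charge odd true) + x ^ (k * charge odd false)
      ≡⟨ charge-sum odd k ⟩
    1 + x ^ k ∎
    where
    pointwise : (ε : Vec Bool 1) →
      x ^ chargedDhat odd k ε (a V.∷ V.[]) ≡ x ^ (k * charge odd (V.head ε) + 0)
    pointwise (s V.∷ V.[]) = refl

  signedSum-∷ : ∀ odd k {m} a (w : Vec ℕ (suc m)) → a ≢ V.head w →
    signedSum odd k (a V.∷ w)
      ≡ (1 + x ^ (k + b2n (V.head w <ᵇ a))) * signedSum (not odd) (b2n (a <ᵇ V.head w)) w
  signedSum-∷ odd k a w a≢b = begin
    signedSum odd k (a V.∷ w)
      ≡⟨ cong sum (List.map-cong (cong (x ^_) ∘ chargedDhat-∷ odd k a w a≢b) (allSigns _)) ⟩
    sum (map (λ ε → x ^ (c * charge odd (V.head ε) + chargedDhat (not odd) k′ (V.tail ε) w))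
             (allSigns _))
      ≡⟨ sum-allSigns-suc (λ s → c * charge odd s) (λ ε → chargedDhat (not odd) k′ ε w) ⟩
    (x ^ (c * charge odd true) + x ^ (c * charge odd false)) * signedSum (not odd) k′ w
      ≡⟨ cong (_* signedSum (not odd) k′ w) (charge-sum odd c) ⟩
    (1 + x ^ c) * signedSum (not odd) k′ w ∎
    where
    c = k + b2n (V.head w <ᵇ a)
    k′ = b2n (a <ᵇ V.head w)

  signedSum≡tripleProduct : ∀ odd l r {m} (w : Vec ℕ (suc m)) →
    Linked _≢_ (V.toList w) → All (_< r) (V.toList w) →
    signedSum odd (b2n (l <ᵇ V.head w)) w
      ≡ tripleProduct (λ a b c → 1 + x ^ smallerNeighbours a b c) (l ∷ V.toList w ++ r ∷ [])
  signedSum≡tripleProduct odd l r (a V.∷ V.[]) [-] (a<r ∷ []) = begin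
    signedSum odd (b2n (l <ᵇ a)) (a V.∷ V.[])
      ≡⟨ signedSum-[-] odd (b2n (l <ᵇ a)) a ⟩
    1 + x ^ b2n (l <ᵇ a)
      ≡⟨ cong (λ e → 1 + x ^ e) (sym right-sentinel) ⟩
    1 + x ^ smallerNeighbours l a r
      ≡⟨ ℕ.*-identityʳ _ ⟨
    (1 + x ^ smallerNeighbours l a r) * 1 ∎
    where
    right-sentinel : smallerNeighbours l a r ≡ b2n (l <ᵇ a)
    right-sentinel rewrite <ᵇ-false (ℕ.<⇒≤ a<r) = ℕ.+-identityʳ _
  signedSum≡tripleProduct odd l r (a V.∷ b V.∷ w) (a≢b ∷ linked) (_ ∷ below) =
    trans (signedSum-∷ odd (b2n (l <ᵇ a)) a (b V.∷ w) a≢b)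
          (cong ((1 + x ^ smallerNeighbours l a b) *_)
                (signedSum≡tripleProduct (not odd) a r (b V.∷ w) linked below))

  typeWeight : ℕ → ℕ → ℕ → ℕ
  typeWeight a b c = (1 + x) ^ b2n (isDoubleAscentOrDescent a b c) * 2 ^ b2n (isValley a b c)
                     * (1 + x * x) ^ b2n (isPeak a b c)

  peak-weight : (1 + x) ^ 0 * 2 ^ 0 * (1 + x * x) ^ 1 ≡ 1 + x ^ 2
  peak-weight = arith x
    where
    arith : ∀ x → 1 * 1 * ((1 + x * x) * 1) ≡ 1 + x * (x * 1)
    arith = solve-∀

  monotone-weight : (1 + x) ^ 1 * 2 ^ 0 * (1 + x * x) ^ 0 ≡ 1 + x ^ 1
  monotone-weight = arith x
    where
    arith : ∀ x → (1 + x) * 1 * 1 * 1 ≡ 1 + x * 1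
    arith = solve-∀

  typeWeight≡1+x^smallerNeighbours : ∀ {a b c} → a ≢ b → b ≢ c →
    typeWeight a b c ≡ 1 + x ^ smallerNeighbours a b c
  typeWeight≡1+x^smallerNeighbours {a} {b} {c} a≢b b≢c with ℕ.<-cmp a b | ℕ.<-cmp c b
  ... | tri≈ _ a≡b _ | _ = ⊥-elim (a≢b a≡b)
  ... | _ | tri≈ _ c≡b _ = ⊥-elim (b≢c (sym c≡b))
  ... | tri< a<b _ _ | tri< c<b _ _
    rewrite <ᵇ-true a<b | <ᵇ-false (ℕ.<⇒≤ a<b) | <ᵇ-true c<b | <ᵇ-false (ℕ.<⇒≤ c<b) = peak-weight
  ... | tri< a<b _ _ | tri> _ _ b<c
    rewrite <ᵇ-true a<b | <ᵇ-false (ℕ.<⇒≤ a<b) | <ᵇ-true b<c | <ᵇ-false (ℕ.<⇒≤ b<c) = monotone-weight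
  ... | tri> _ _ b<a | tri< c<b _ _
    rewrite <ᵇ-true b<a | <ᵇ-false (ℕ.<⇒≤ b<a) | <ᵇ-true c<b | <ᵇ-false (ℕ.<⇒≤ c<b) = monotone-weight
  ... | tri> _ _ b<a | tri> _ _ b<c
    rewrite <ᵇ-true b<a | <ᵇ-false (ℕ.<⇒≤ b<a) | <ᵇ-true b<c | <ᵇ-false (ℕ.<⇒≤ b<c) = refl

toList-tabulate : ∀ {A : Set} {n} (f : Fin n → A) → V.toList (V.tabulate f) ≡ List.tabulate f
toList-tabulate {n = zero} f = refl
toList-tabulate {n = suc n} f = cong (f Fin.zero ∷_) (toList-tabulate (f ∘ Fin.suc))

⟨$⟩ʳ-injective : ∀ {n} (σ : Permutation′ n) {i j} → σ ⟨$⟩ʳ i ≡ σ ⟨$⟩ʳ j → i ≡ j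
⟨$⟩ʳ-injective σ {i} {j} σi≡σj = begin
  i                     ≡⟨ inverseˡ σ ⟨
  σ ⟨$⟩ˡ (σ ⟨$⟩ʳ i)     ≡⟨ cong (σ ⟨$⟩ˡ_) σi≡σj ⟩
  σ ⟨$⟩ˡ (σ ⟨$⟩ʳ j)     ≡⟨ inverseˡ σ ⟩
  j                     ∎

word-linked : ∀ {n} (σ : Permutation′ n) → Linked _≢_ (V.toList (word σ))
word-linked σ rewrite toList-tabulate (λ i → suc (toℕ (σ ⟨$⟩ʳ i))) =
  AllPairs⇒Linked (Unique.tabulate⁺
    (⟨$⟩ʳ-injective σ ∘ Fin.toℕ-injective ∘ ℕ.suc-injective))

word-below : ∀ {n} (σ : Permutation′ n) → All (_< suc n) (V.toList (word σ))
word-below σ rewrite toList-tabulate (λ i → suc (toℕ (σ ⟨$⟩ʳ i))) =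
  All.tabulate⁺ (λ i → s≤s (Fin.toℕ<n (σ ⟨$⟩ʳ i)))

linked-++-larger : ∀ {r L} → All (_< r) L → Linked _≢_ L → Linked _≢_ (L ++ r ∷ [])
linked-++-larger [] [] = [-]
linked-++-larger (a<r ∷ []) [-] = ℕ.<⇒≢ a<r ∷ [-]
linked-++-larger (_ ∷ below) (a≢b ∷ linked) = a≢b ∷ linked-++-larger below linked

extWord-linked : ∀ {n} (σ : Permutation′ (suc n)) → Linked _≢_ (extWord σ)
extWord-linked σ with word-below σ
... | σ₁<sentinel ∷ below = ℕ.>⇒≢ σ₁<sentinel ∷ linked-++-larger (σ₁<sentinel ∷ below) (word-linked σ)

lemma2p2 : (n : ℕ) → n ≥ 1 → (σ : Permutation′ n) → (x : ℕ) →
    sum (map (λ π → x ^ dhat π) (Orb σ))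
    ≡ (1 + x) ^ dda σ * 2 ^ val σ * (1 + x * x) ^ pk σ
lemma2p2 (suc m) _ σ x = begin
  sum (map (λ π → x ^ dhat π) (Orb σ))
    ≡⟨ cong sum (List.map-∘ (allSigns (suc m))) ⟨
  signedSum x true 0 (word σ)
    ≡⟨ cong (λ k → signedSum x true (b2n k) (word σ)) (<ᵇ-false (ℕ.<⇒≤ σ₁<sentinel)) ⟨
  signedSum x true (b2n (suc (suc m) <ᵇ V.head (word σ))) (word σ)
    ≡⟨ signedSum≡tripleProduct x true (suc (suc m)) (suc (suc m)) (word σ)
                                (word-linked σ) (word-below σ) ⟩
  tripleProduct (λ a b c → 1 + x ^ smallerNeighbours a b c) (extWord σ)
    ≡⟨ tripleProduct-cong (typeWeight≡1+x^smallerNeighbours x) (extWord-linked σ) ⟨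
  tripleProduct (typeWeight x) (extWord σ)
    ≡⟨ powers-countTriples (1 + x) 2 (1 + x * x) isDoubleAscentOrDescent isValley isPeak
                           (extWord σ) ⟨
  (1 + x) ^ dda σ * 2 ^ val σ * (1 + x * x) ^ pk σ ∎
  where
  σ₁<sentinel : V.head (word σ) < suc (suc m)
  σ₁<sentinel = s≤s (Fin.toℕ<n (σ ⟨$⟩ʳ Fin.zero))
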